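{- Let $\mathrm{ext}\ge3$, $\mathrm{per}=010^{\mathrm{ext}}$ and $q\in 0101*11\overline{11}*\overline{10010}$. Let $k$ be a positive integer and let $a,b\ge k$ be integers. If a sequence of $m$ hairpin completion operations transforms $\mathrm{per}^k\cdot q\cdot\overleftarrow{\mathrm{per}}^k$ into $\mathrm{per}^a\cdot q\cdot\overleftarrow{\mathrm{per}}^b$, then $\min\{a,b\}\le k\cdot\mathrm{Fib}(m)$ and $\max\{a,b\}\le k\cdot\mathrm{Fib}(m+1)$.
   Context: Alphabet $\{0,1\}$, $\overline{0}=1$, $\overline{1}=0$; $\overline{X}$ applies the bar symbolwise, $\overleftarrow{X}=\overline{X[|X|]}\cdots\overline{X[1]}$. For strings $a,b,c$, $a*b*c$ is the set of strings $a\,w_1\,b\,w_2\,c$ with $w_1,w_2$ arbitrary. Hairpin completion (modified definition): a right completion of length $\ell\in[1..|W|]$ transforms $W$ into $W\cdot\overleftarrow{W[1..\ell]}$, a left completion of length $\ell$ transforms $W$ into $\overleftarrow{W[|W|-\ell+1..|W|]}\cdot W$. Fibonacci: $\mathrm{Fib}(0)=\mathrm{Fib}(1)=1$, $\mathrm{Fib}(i)=\mathrm{Fib}(i-1)+\mathrm{Fib}(i-2)$. -}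

module Defs where

open import Data.Bool using (Bool; true; false; not)
open import Data.Nat using (ℕ; zero; suc; _+_; _∸_; _≤_)
open import Data.List using (List; []; _∷_; _++_; map; reverse; take; drop; length; replicate; concat)
open import Data.Product using (∃; ∃-syntax; _×_; _,_)
open import Data.Sum using (_⊎_)
open import Relation.Binary.PropositionalEquality using (_≡_)

-- Alphabet {0,1} encoded as Bool with 0 = false, 1 = true.
Word : Set
Word = List Bool

bar : Word → Word
bar = map not

rc : Word → Word
rc X = reverse (bar X)

pow : Word → ℕ → Word
pow X k = concat (replicate k X)

Fib : ℕ → ℕ
Fib zero = 1
Fib (suc zero) = 1
Fib (suc (suc i)) = Fib (suc i) + Fib i

InPattern : Word → Word → Word → Word → Set
InPattern a b c q = ∃[ w₁ ] ∃[ w₂ ] (q ≡ a ++ w₁ ++ b ++ w₂ ++ c)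

data HairpinStep (W : Word) : Word → Set where
  right : (ℓ : ℕ) → 1 ≤ ℓ → ℓ ≤ length W →
          HairpinStep W (W ++ rc (take ℓ W))
  left  : (ℓ : ℕ) → 1 ≤ ℓ → ℓ ≤ length W →
          HairpinStep W (rc (drop (length W ∸ ℓ) W) ++ W)

data HairpinSeq : ℕ → Word → Word → Set where
  done : ∀ {W} → HairpinSeq zero W W
  step : ∀ {m U V W} → HairpinStep U V → HairpinSeq m V W → HairpinSeq (suc m) U W

per : ℕ → Word
per ext = false ∷ true ∷ replicate ext false

-- Every word of the completion sequence occurs in the final word F = per^a q rc(per)^b as a
-- window around q, reaching x letters into per^a and y letters into rc(per)^b. In per^a the letters
-- 1, and in rc(per)^b the letters 0, are exactly P = ext + 2 ≥ 5 apart, whereas q begins with 0101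
-- and ends with 01101. A hairpin completion appends the reverse complement of a prefix or suffix of
-- the window, and must agree with F; comparing the two shows that a completion cannot copy much of
-- q, and that copying part of a period forces the new end of the window onto a period boundary.
-- Hence if x ≤ X·P and y ≤ Y·P, a right completion keeps y ≤ (X + Y)·P and a left one x ≤ (X + Y)·P.
-- The start word sits at x = y = kP, so (X, Y) starts at (k, k) and evolves by (X, Y) ↦ (X, X + Y)
-- or (X + Y, Y), and at the end a ≤ X, b ≤ Y; these pairs are bounded by k·Fib m and k·Fib (m + 1).

module Submission where

open import Defs
open import Data.Bool using (Bool; true; false; not)
open import Data.Bool.Properties using (not-involutive)
open import Data.Empty using (⊥; ⊥-elim)
open import Data.List using ([]; _∷_; _++_; _∷ʳ_; [_]; length; take; drop; replicate)
open import Data.List.Properties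
  using (++-assoc; length-++; length-map; length-reverse; length-take; length-drop; length-replicate; unfold-reverse)
open import Data.Nat
  using (ℕ; zero; suc; _+_; _*_; _∸_; _≤_; _<_; _⊓_; _⊔_; z≤n; s≤s; z<s; s<s; s≤s⁻¹; >-nonZero; _≤?_; _<?_)
open import Data.Nat.Divisibility using (_∣_; divides; >⇒∤; ∣m+n∣m⇒∣n; n∣n; n∣m*n; _∣0)
open import Data.Nat.DivMod using (_/_; _%_; m≡m%n+[m/n]*n; m%n<n; m<n*o⇒m/o<n)
open import Data.Nat.Properties
open import Data.Nat.Tactic.RingSolver using (solve; solve-∀)
open import Data.Product using (_×_; _,_)
open import Data.Sum using (inj₁; inj₂)
open import Function using (_∘_)
open import Relation.Binary.Definitions using (tri<; tri≈; tri>)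
open import Relation.Binary.PropositionalEquality
  using (_≡_; refl; sym; trans; cong; cong₂; subst; subst₂; module ≡-Reasoning)
open import Relation.Nullary using (Dec; yes; no)

open ≡-Reasoning

∣-apart : ∀ {n m d} → n ∣ m → n ∣ m + d → 0 < d → d < n → ⊥
∣-apart n∣m n∣m+d 0<d d<n = >⇒∤ {{>-nonZero 0<d}} d<n (∣m+n∣m⇒∣n n∣m+d n∣m)

∣⇒≤-rounded : ∀ {n m j W} → n ∣ m + j → m ≤ W * n → j < n → m + j ≤ W * n
∣⇒≤-rounded {n} {m} {j} {W} (divides c m+j≡) m≤ j< =
  subst (_≤ W * n) (sym m+j≡) (*-monoˡ-≤ n (s≤s⁻¹ (*-cancelʳ-< n c (suc W) c*n<)))
  where
  c*n< : c * n < suc W * n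
  c*n< = subst (_< suc W * n) m+j≡ (subst (m + j <_) (+-comm (W * n) n) (+-mono-≤-< m≤ j<))

+-≤-*ʳ : ∀ X Y c {m n} → m ≤ X * c → n ≤ Y * c → m + n ≤ (X + Y) * c
+-≤-*ʳ X Y c {m} {n} m≤ n≤ = subst (m + n ≤_) (sym (*-distribʳ-+ c X Y)) (+-mono-≤ m≤ n≤)

m+n≡m⊓n+m⊔n : ∀ m n → m + n ≡ m ⊓ n + (m ⊔ n)
m+n≡m⊓n+m⊔n m n with ≤-total m n
... | inj₁ m≤n = sym (cong₂ _+_ (m≤n⇒m⊓n≡m m≤n) (m≤n⇒m⊔n≡n m≤n))
... | inj₂ n≤m = trans (+-comm m n) (sym (cong₂ _+_ (m≥n⇒m⊓n≡n n≤m) (m≥n⇒m⊔n≡m n≤m)))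

-- Total indexing: positions at or beyond the end read as false.
at : Word → ℕ → Bool
at []       _       = false
at (x ∷ _)  zero    = x
at (_ ∷ xs) (suc p) = at xs p

at-++ˡ : ∀ xs ys {p} → p < length xs → at (xs ++ ys) p ≡ at xs p
at-++ˡ (x ∷ xs) ys {zero}  _         = refl
at-++ˡ (x ∷ xs) ys {suc p} (s≤s p<) = at-++ˡ xs ys p<

at-++ʳ : ∀ xs ys p → at (xs ++ ys) (length xs + p) ≡ at ys p
at-++ʳ []       ys p = refl
at-++ʳ (x ∷ xs) ys p = at-++ʳ xs ys p

at-take : ∀ n xs {p} → p < n → at (take n xs) p ≡ at xs p
at-take (suc n) []       _         = refl
at-take (suc n) (x ∷ xs) {zero}  _ = refl
at-take (suc n) (x ∷ xs) {suc p} (s≤s p<n) = at-take n xs p<n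

at-drop : ∀ n xs p → at (drop n xs) p ≡ at xs (n + p)
at-drop zero    xs       p = refl
at-drop (suc n) []       p = refl
at-drop (suc n) (x ∷ xs) p = at-drop n xs p

length-rc : ∀ xs → length (rc xs) ≡ length xs
length-rc xs = trans (length-reverse (bar xs)) (length-map not xs)

rc-∷ : ∀ x xs → rc (x ∷ xs) ≡ rc xs ∷ʳ not x
rc-∷ x xs = unfold-reverse (not x) (bar xs)

at-rc : ∀ xs {i r} → i + suc r ≡ length xs → at (rc xs) i ≡ not (at xs r)
at-rc []       {i} {r} eq with () ← trans (sym (+-suc i r)) eq
at-rc (x ∷ xs) {i} {zero} eq = begin
  at (rc (x ∷ xs)) i                            ≡⟨ cong (λ w → at w i) (rc-∷ x xs) ⟩
  at (rc xs ++ [ not x ]) i                      ≡⟨ cong (at (rc xs ++ [ not x ])) i≡ ⟩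
  at (rc xs ++ [ not x ]) (length (rc xs) + 0)   ≡⟨ at-++ʳ (rc xs) [ not x ] 0 ⟩
  not x                                          ∎
  where
  i≡ : i ≡ length (rc xs) + 0
  i≡ = trans (suc-injective (trans (+-comm 1 i) eq)) (sym (trans (+-identityʳ _) (length-rc xs)))
at-rc (x ∷ xs) {i} {suc r} eq = begin
  at (rc (x ∷ xs)) i          ≡⟨ cong (λ w → at w i) (rc-∷ x xs) ⟩
  at (rc xs ++ [ not x ]) i    ≡⟨ at-++ˡ (rc xs) [ not x ] (subst (i <_) (sym (length-rc xs)) i<) ⟩
  at (rc xs) i                 ≡⟨ at-rc xs eq′ ⟩
  not (at xs r)                ∎
  where
  eq′ : i + suc r ≡ length xs
  eq′ = suc-injective (trans (sym (+-suc i (suc r))) eq)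
  i< : i < length xs
  i< = subst (i <_) eq′ (m<m+n i z<s)

length-pow : ∀ w n → length (pow w n) ≡ n * length w
length-pow w zero    = refl
length-pow w (suc n) = trans (length-++ w) (cong (length w +_) (length-pow w n))

at-pow : ∀ w n {c r} → c < n → r < length w → at (pow w n) (c * length w + r) ≡ at w r
at-pow w (suc n) {zero}  _         r< = at-++ˡ w (pow w n) r<
at-pow w (suc n) {suc c} {r} (s≤s c<n) r< = begin
  at (w ++ pow w n) (length w + c * length w + r)    ≡⟨ cong (at (w ++ pow w n)) (+-assoc (length w) _ r) ⟩
  at (w ++ pow w n) (length w + (c * length w + r))  ≡⟨ at-++ʳ w (pow w n) _ ⟩
  at (pow w n) (c * length w + r)                    ≡⟨ at-pow w n c<n r< ⟩
  at w r                                             ∎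

-- If v occurs in w only at r₀, then in a power of w it occurs only at positions ≡ r₀ modulo |w|,
-- written here as |w| ∣ p + d with r₀ + d = |w|.
at-pow-residue : ∀ w n {v r₀ d p} → (∀ {r} → r < length w → at w r ≡ v → r ≡ r₀) →
  r₀ + d ≡ length w → p < n * length w → at (pow w n) p ≡ v → length w ∣ p + d
at-pow-residue [] n {p = p} _ _ p< _ with () ← subst (p <_) (*-zeroʳ n) p<
at-pow-residue w@(_ ∷ _) n {v} {r₀} {d} {p} only r₀+d p< atp≡v = divides (suc c) (begin
  p + d                     ≡⟨ cong (_+ d) p≡ ⟩
  c * W + r + d             ≡⟨ cong (λ t → c * W + t + d) r≡r₀ ⟩
  c * W + r₀ + d            ≡⟨ +-assoc (c * W) r₀ d ⟩
  c * W + (r₀ + d)          ≡⟨ cong (c * W +_) r₀+d ⟩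
  c * W + W                 ≡⟨ +-comm (c * W) W ⟩
  suc c * W                 ∎)
  where
  W : ℕ
  W = length w
  c : ℕ
  c = p / W
  r : ℕ
  r = p % W
  p≡ : p ≡ c * W + r
  p≡ = trans (m≡m%n+[m/n]*n p W) (+-comm r (c * W))
  r≡r₀ : r ≡ r₀
  r≡r₀ = only (m%n<n p W) (trans (sym (at-pow w n (m<n*o⇒m/o<n p<) (m%n<n p W))) (trans (cong (at (pow w n)) (sym p≡)) atp≡v))

at-pow-residue⁻¹ : ∀ w n {r₀ d p} → 0 < d → r₀ + d ≡ length w → p < n * length w →
  length w ∣ p + d → at (pow w n) p ≡ at w r₀
at-pow-residue⁻¹ w n {d = d} {p} 0<d _ _ (divides zero p+d≡0) with () ← ≤-trans 0<d (subst (d ≤_) p+d≡0 (m≤n+m d p))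
at-pow-residue⁻¹ w n {r₀} {d} {p} 0<d r₀+d p< (divides (suc c) p+d≡) =
  trans (cong (at (pow w n)) p≡) (at-pow w n c<n (subst (r₀ <_) r₀+d (m<m+n r₀ 0<d)))
  where
  W : ℕ
  W = length w
  p≡ : p ≡ c * W + r₀
  p≡ = +-cancelʳ-≡ d p (c * W + r₀) (begin
    p + d              ≡⟨ p+d≡ ⟩
    W + c * W          ≡⟨ +-comm W (c * W) ⟩
    c * W + W          ≡⟨ cong (c * W +_) (sym r₀+d) ⟩
    c * W + (r₀ + d)   ≡⟨ +-assoc (c * W) r₀ d ⟨
    c * W + r₀ + d     ∎)
  c<n : c < n
  c<n = *-cancelʳ-< W c n (≤-<-trans (subst (c * W ≤_) (sym p≡) (m≤m+n (c * W) r₀)) p<)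

at-replicate-false : ∀ n r → at (replicate n false) r ≡ false
at-replicate-false zero    r       = refl
at-replicate-false (suc n) zero    = refl
at-replicate-false (suc n) (suc r) = at-replicate-false n r

-- Occurrences and hairpin completions

record OccursAt (U W : Word) (s : ℕ) : Set where
  field
    fits   : s + length U ≤ length W
    agrees : ∀ {p} → p < length U → at W (s + p) ≡ at U p

open OccursAt

occursAt-refl : ∀ W → OccursAt W W 0
occursAt-refl W = record { fits = ≤-refl ; agrees = λ _ → refl }

occursAt-prefix : ∀ U X → OccursAt U (U ++ X) 0
occursAt-prefix U X = record
  { fits   = subst (length U ≤_) (sym (length-++ U)) (m≤m+n (length U) (length X))
  ; agrees = at-++ˡ U X }

occursAt-suffix : ∀ X U → OccursAt U (X ++ U) (length X)
occursAt-suffix X U = record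
  { fits   = ≤-reflexive (sym (length-++ X))
  ; agrees = λ {p} _ → at-++ʳ X U p }

occursAt-trans : ∀ {U V W s t} → OccursAt U V s → OccursAt V W t → OccursAt U W (t + s)
occursAt-trans {U} {V} {W} {s} {t} U⊑V V⊑W = record
  { fits   = subst (_≤ length W) (sym (+-assoc t s (length U))) (≤-trans (+-monoʳ-≤ t (fits U⊑V)) (fits V⊑W))
  ; agrees = λ {p} p< → begin
      at W (t + s + p)    ≡⟨ cong (at W) (+-assoc t s p) ⟩
      at W (t + (s + p))  ≡⟨ agrees V⊑W (<-≤-trans (+-monoʳ-< s p<) (fits U⊑V)) ⟩
      at V (s + p)        ≡⟨ agrees U⊑V p< ⟩
      at U p              ∎ }

length-rightCompletion : ∀ U {ℓ} → ℓ ≤ length U → length (U ++ rc (take ℓ U)) ≡ length U + ℓ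
length-rightCompletion U {ℓ} ℓ≤ =
  trans (length-++ U) (cong (length U +_) (trans (length-rc (take ℓ U)) (trans (length-take ℓ U) (m≤n⇒m⊓n≡m ℓ≤))))

length-leftFlank : ∀ U {ℓ} → ℓ ≤ length U → length (rc (drop (length U ∸ ℓ) U)) ≡ ℓ
length-leftFlank U {ℓ} ℓ≤ = trans (length-rc (drop (length U ∸ ℓ) U)) (trans (length-drop (length U ∸ ℓ) U) (m∸[m∸n]≡n ℓ≤))

length-leftCompletion : ∀ U {ℓ} → ℓ ≤ length U → length (rc (drop (length U ∸ ℓ) U) ++ U) ≡ length U + ℓ
length-leftCompletion U {ℓ} ℓ≤ =
  trans (length-++ (rc (drop (length U ∸ ℓ) U))) (trans (cong (_+ length U) (length-leftFlank U ℓ≤)) (+-comm ℓ (length U)))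

offset : ∀ {n U W} → HairpinSeq n U W → ℕ
offset done                    = 0
offset (step (right _ _ _) sq) = offset sq
offset (step (left ℓ _ _) sq)  = offset sq + ℓ

offset-occursAt : ∀ {n U W} (sq : HairpinSeq n U W) → OccursAt U W (offset sq)
offset-occursAt {W = W} done = occursAt-refl W
offset-occursAt (step {U = U} (right ℓ _ _) sq) =
  subst (OccursAt U _) (+-identityʳ (offset sq)) (occursAt-trans (occursAt-prefix U _) (offset-occursAt sq))
offset-occursAt (step {U = U} (left ℓ _ ℓ≤) sq) =
  subst (OccursAt U _) (cong (offset sq +_) (length-leftFlank U ℓ≤)) (occursAt-trans (occursAt-suffix _ U) (offset-occursAt sq))

-- W[q, q + ℓ) is the reverse complement of W[p, p + ℓ).
RcFactors : Word → ℕ → ℕ → ℕ → Set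
RcFactors W ℓ p q = ∀ {i r} → i + suc r ≡ ℓ → at W (q + i) ≡ not (at W (p + r))

module _ {i r ℓ : ℕ} (i+1+r : i + suc r ≡ ℓ) where
  pair-swap : r + suc i ≡ ℓ
  pair-swap = trans (+-suc r i) (trans (cong suc (+-comm r i)) (trans (sym (+-suc i r)) i+1+r))

  pair-fst< : i < ℓ
  pair-fst< = subst (i <_) i+1+r (m<m+n i z<s)

  pair-snd< : r < ℓ
  pair-snd< = subst (r <_) i+1+r (m≤n+m (suc r) i)

rcFactors-sym : ∀ {W ℓ p q} → RcFactors W ℓ p q → RcFactors W ℓ q p
rcFactors-sym {W} {ℓ} {p} {q} h {i} {r} i+1+r = begin
  at W (p + i)               ≡⟨ not-involutive _ ⟨
  not (not (at W (p + i)))   ≡⟨ cong not (h (pair-swap i+1+r)) ⟨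
  not (at W (q + r))         ∎

occursAt-rcFactors : ∀ {V W ℓ q t} → OccursAt V W t → RcFactors V ℓ 0 q → q + ℓ ≤ length V → RcFactors W ℓ t (t + q)
occursAt-rcFactors {V} {W} {ℓ} {q} {t} V⊑W h q+ℓ≤ {i} {r} i+1+r = begin
  at W (t + q + i)     ≡⟨ cong (at W) (+-assoc t q i) ⟩
  at W (t + (q + i))   ≡⟨ agrees V⊑W (<-≤-trans (+-monoʳ-< q (pair-fst< i+1+r)) q+ℓ≤) ⟩
  at V (q + i)         ≡⟨ h i+1+r ⟩
  not (at V r)         ≡⟨ cong not (agrees V⊑W (<-≤-trans (pair-snd< i+1+r) (≤-trans (m≤n+m ℓ q) q+ℓ≤))) ⟨
  not (at W (t + r))   ∎

rightCompletion-rcFactors : ∀ U {ℓ} → ℓ ≤ length U → RcFactors (U ++ rc (take ℓ U)) ℓ 0 (length U)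
rightCompletion-rcFactors U {ℓ} ℓ≤ {i} {r} i+1+r = begin
  at (U ++ rc (take ℓ U)) (length U + i)   ≡⟨ at-++ʳ U _ i ⟩
  at (rc (take ℓ U)) i                     ≡⟨ at-rc (take ℓ U) (trans i+1+r (sym (trans (length-take ℓ U) (m≤n⇒m⊓n≡m ℓ≤)))) ⟩
  not (at (take ℓ U) r)                    ≡⟨ cong not (at-take ℓ U r<ℓ) ⟩
  not (at U r)                             ≡⟨ cong not (at-++ˡ U _ (<-≤-trans r<ℓ ℓ≤)) ⟨
  not (at (U ++ rc (take ℓ U)) r)          ∎
  where
  r<ℓ : r < ℓ
  r<ℓ = pair-snd< i+1+r

leftCompletion-rcFactors : ∀ U {ℓ} → ℓ ≤ length U → RcFactors (rc (drop (length U ∸ ℓ) U) ++ U) ℓ 0 (length U)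
leftCompletion-rcFactors U {ℓ} ℓ≤ = rcFactors-sym {W = D′ ++ U} {p = length U} {q = 0} suffix-complements-prefix
  where
  D : Word
  D = drop (length U ∸ ℓ) U
  D′ : Word
  D′ = rc D
  position : ∀ r → length D′ + (length U ∸ ℓ + r) ≡ length U + r
  position r = begin
    length D′ + (length U ∸ ℓ + r)   ≡⟨ cong (_+ (length U ∸ ℓ + r)) (length-leftFlank U ℓ≤) ⟩
    ℓ + (length U ∸ ℓ + r)           ≡⟨ +-assoc ℓ (length U ∸ ℓ) r ⟨
    ℓ + (length U ∸ ℓ) + r           ≡⟨ cong (_+ r) (m+[n∸m]≡n ℓ≤) ⟩
    length U + r                     ∎
  suffix-complements-prefix : RcFactors (D′ ++ U) ℓ (length U) 0
  suffix-complements-prefix {i} {r} i+1+r = begin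
    at (D′ ++ U) i                               ≡⟨ at-++ˡ D′ U (subst (i <_) (sym (length-leftFlank U ℓ≤)) (pair-fst< i+1+r)) ⟩
    at D′ i                                      ≡⟨ at-rc D (trans i+1+r (sym (trans (length-drop (length U ∸ ℓ) U) (m∸[m∸n]≡n ℓ≤)))) ⟩
    not (at D r)                                 ≡⟨ cong not (at-drop (length U ∸ ℓ) U r) ⟩
    not (at U (length U ∸ ℓ + r))                ≡⟨ cong not (at-++ʳ D′ U _) ⟨
    not (at (D′ ++ U) (length D′ + (length U ∸ ℓ + r)))  ≡⟨ cong (λ p → not (at (D′ ++ U) p)) (position r) ⟩
    not (at (D′ ++ U) (length U + r))            ∎

-- Fibonacci bounds

record FibBounded (k i X Y : ℕ) : Set where
  constructor _,_
  field
    min≤ : X ⊓ Y ≤ k * Fib i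
    max≤ : X ⊔ Y ≤ k * Fib (suc i)

fibBounded-base : ∀ k → FibBounded k 0 k k
fibBounded-base k = bound (⊓-idem k) , bound (⊔-idem k)
  where
  bound : ∀ {m} → m ≡ k → m ≤ k * 1
  bound m≡k = ≤-reflexive (trans m≡k (sym (*-identityʳ k)))

fibBounded-mono : ∀ {k i a b X Y} → a ≤ X → b ≤ Y → FibBounded k i X Y → FibBounded k i a b
fibBounded-mono a≤X b≤Y (lo , hi) = ≤-trans (⊓-mono-≤ a≤X b≤Y) lo , ≤-trans (⊔-mono-≤ a≤X b≤Y) hi

fibBounded-swap : ∀ {k i X Y} → FibBounded k i X Y → FibBounded k i Y X
fibBounded-swap {X = X} {Y} (lo , hi) = subst (_≤ _) (⊓-comm X Y) lo , subst (_≤ _) (⊔-comm X Y) hi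

*-Fib-step : ∀ k i → k * Fib i + k * Fib (suc i) ≡ k * Fib (suc (suc i))
*-Fib-step k i = trans (+-comm (k * Fib i) _) (sym (*-distribˡ-+ k (Fib (suc i)) (Fib i)))

fibBounded-right : ∀ {k i X Y} → FibBounded k i X Y → FibBounded k (suc i) X (X + Y)
fibBounded-right {k} {i} {X} {Y} (lo , hi) =
  subst (_≤ _) (sym (m≤n⇒m⊓n≡m (m≤m+n X Y))) (≤-trans (m≤m⊔n X Y) hi) ,
  subst (_≤ _) (sym (m≤n⇒m⊔n≡n (m≤m+n X Y)))
    (subst₂ _≤_ (sym (m+n≡m⊓n+m⊔n X Y)) (*-Fib-step k i) (+-mono-≤ lo hi))

fibBounded-left : ∀ {k i X Y} → FibBounded k i X Y → FibBounded k (suc i) (X + Y) Y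
fibBounded-left {k} {i} {X} {Y} b =
  subst (λ Z → FibBounded k (suc i) Z Y) (+-comm Y X) (fibBounded-swap (fibBounded-right (fibBounded-swap b)))

-- The word per^a q rc(per)^b

-- The letters of q = 0101 ⋯ 11 00 ⋯ 01101 that the argument uses.
record Markers (q : Word) : Set where
  field
    one₁    : at q 1 ≡ true
    one₃    : at q 3 ≡ true
    n₀      : ℕ
    length≡ : length q ≡ n₀ + 5
    zero₀   : at q n₀ ≡ false
    zero₃   : at q (n₀ + 3) ≡ false

inPattern⇒markers : ∀ {q} → InPattern (false ∷ true ∷ false ∷ true ∷ []) (true ∷ true ∷ bar (true ∷ true ∷ []))
  (bar (true ∷ false ∷ false ∷ true ∷ false ∷ [])) q → Markers q
inPattern⇒markers (w₁ , w₂ , refl) = record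
  { one₁    = refl
  ; one₃    = refl
  ; n₀      = length X
  ; length≡ = trans (cong length split) (length-++ X)
  ; zero₀   = trans (cong (λ w → at w (length X)) split) (trans (cong (at (X ++ end)) (sym (+-identityʳ (length X)))) (at-++ʳ X end 0))
  ; zero₃   = trans (cong (λ w → at w (length X + 3)) split) (at-++ʳ X end 3)
  }
  where
  end : Word
  end = bar (true ∷ false ∷ false ∷ true ∷ false ∷ [])
  X : Word
  X = false ∷ true ∷ false ∷ true ∷ w₁ ++ true ∷ true ∷ bar (true ∷ true ∷ []) ++ w₂
  split : false ∷ true ∷ false ∷ true ∷ w₁ ++ true ∷ true ∷ bar (true ∷ true ∷ []) ++ w₂ ++ end ≡ X ++ end
  split = cong (λ w → false ∷ true ∷ false ∷ true ∷ w) (sym (++-assoc w₁ _ end))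

module Period (e : ℕ) where

  P : ℕ
  P = suc (suc e)

  e+2≡P : e + 2 ≡ P
  e+2≡P = +-comm e 2

  e<n*P : ∀ {n} → 0 < n → e < n * P
  e<n*P {n} 0<n = <-≤-trans (m<n+m e {2} z<s) (m≤n*m P n {{>-nonZero 0<n}})

  length-per : length (per e) ≡ P
  length-per = cong (suc ∘ suc) (length-replicate e)

  length-rc-per : length (rc (per e)) ≡ P
  length-rc-per = trans (length-rc (per e)) length-per

  per-one : ∀ {r} → at (per e) r ≡ true → r ≡ 1
  per-one {zero}        ()
  per-one {suc zero}    _ = refl
  per-one {suc (suc r)} h with () ← trans (sym (at-replicate-false e r)) h

  rc-per-zero : ∀ {r} → r < length (rc (per e)) → at (rc (per e)) r ≡ false → r ≡ e
  rc-per-zero {r} r< h = +-cancelʳ-≡ 2 r e (begin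
    r + 2                 ≡⟨ cong (λ t → r + suc t) (per-one at-r′) ⟨
    r + suc r′            ≡⟨ r+1+r′ ⟩
    length (per e)        ≡⟨ length-per ⟩
    P                     ≡⟨ e+2≡P ⟨
    e + 2                 ∎)
    where
    r′ : ℕ
    r′ = length (per e) ∸ suc r
    r+1+r′ : r + suc r′ ≡ length (per e)
    r+1+r′ = trans (+-suc r r′) (m+[n∸m]≡n (subst (r <_) (length-rc (per e)) r<))
    at-r′ : at (per e) r′ ≡ true
    at-r′ = trans (sym (not-involutive _)) (cong not (trans (sym (at-rc (per e) r+1+r′)) h))

  at-rc-per-e : at (rc (per e)) e ≡ false
  at-rc-per-e = at-rc (per e) (trans e+2≡P (sym length-per))

  length-pow-per : ∀ a → length (pow (per e) a) ≡ a * P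
  length-pow-per a = trans (length-pow (per e) a) (cong (a *_) length-per)

  length-pow-rc-per : ∀ b → length (pow (rc (per e)) b) ≡ b * P
  length-pow-rc-per b = trans (length-pow (rc (per e)) b) (cong (b *_) length-rc-per)

  module Flanked (q : Word) (a b : ℕ) where

    Q : ℕ
    Q = length q

    F : Word
    F = pow (per e) a ++ q ++ pow (rc (per e)) b

    A : ℕ
    A = a * P

    B : ℕ
    B = A + Q

    length-F : length F ≡ B + b * P
    length-F = begin
      length F                                                    ≡⟨ length-++ (pow (per e) a) ⟩
      length (pow (per e) a) + length (q ++ pow (rc (per e)) b)   ≡⟨ cong₂ _+_ (length-pow-per a) (length-++ q) ⟩
      A + (Q + length (pow (rc (per e)) b))                       ≡⟨ cong (λ t → A + (Q + t)) (length-pow-rc-per b) ⟩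
      A + (Q + b * P)                                             ≡⟨ +-assoc A Q (b * P) ⟨
      B + b * P                                                   ∎

    at-F-left : ∀ {p} → p < A → at F p ≡ at (pow (per e) a) p
    at-F-left {p} p< = at-++ˡ (pow (per e) a) _ (subst (p <_) (sym (length-pow-per a)) p<)

    at-F-middle : ∀ {r} → r < Q → at F (A + r) ≡ at q r
    at-F-middle {r} r< = begin
      at F (A + r)                          ≡⟨ cong (λ t → at F (t + r)) (length-pow-per a) ⟨
      at F (length (pow (per e) a) + r)     ≡⟨ at-++ʳ (pow (per e) a) _ r ⟩
      at (q ++ pow (rc (per e)) b) r        ≡⟨ at-++ˡ q _ r< ⟩
      at q r                                ∎

    at-F-right : ∀ u → at F (B + u) ≡ at (pow (rc (per e)) b) u
    at-F-right u = begin
      at F (B + u)                              ≡⟨ cong (at F) (trans (+-assoc A Q u) (cong (_+ (Q + u)) (sym (length-pow-per a)))) ⟩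
      at F (length (pow (per e) a) + (Q + u))   ≡⟨ at-++ʳ (pow (per e) a) _ (Q + u) ⟩
      at (q ++ pow (rc (per e)) b) (Q + u)      ≡⟨ at-++ʳ q _ u ⟩
      at (pow (rc (per e)) b) u                 ∎

    p<a*|per| : ∀ {p} → p < A → p < a * length (per e)
    p<a*|per| {p} = subst (p <_) (cong (a *_) (sym length-per))

    at-F-one : ∀ {p} → p < A → at F p ≡ true → P ∣ p + suc e
    at-F-one {p} p< h = subst (_∣ p + suc e) length-per
      (at-pow-residue (per e) a (λ _ → per-one) (sym length-per) (p<a*|per| p<) (trans (sym (at-F-left p<)) h))

    at-F-one⁻¹ : ∀ {p} → p < A → P ∣ p + suc e → at F p ≡ true
    at-F-one⁻¹ {p} p< P∣ = trans (at-F-left p<)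
      (at-pow-residue⁻¹ (per e) a {r₀ = 1} z<s (sym length-per) (p<a*|per| p<) (subst (_∣ p + suc e) (sym length-per) P∣))

    at-F-zero : ∀ {u} → B + u < length F → at F (B + u) ≡ false → P ∣ u + 2
    at-F-zero {u} u< h = subst (_∣ u + 2) length-rc-per
      (at-pow-residue (rc (per e)) b rc-per-zero (trans e+2≡P (sym length-rc-per)) u<′ (trans (sym (at-F-right u)) h))
      where
      u<′ : u < b * length (rc (per e))
      u<′ = subst (u <_) (cong (b *_) (sym length-rc-per)) (+-cancelˡ-< B u (b * P) (subst (B + u <_) length-F u<))

    at-F-zero⁻¹ : ∀ {u} → u < b * P → P ∣ u + 2 → at F (B + u) ≡ false
    at-F-zero⁻¹ {u} u< P∣ = trans (at-F-right u)
      (trans (at-pow-residue⁻¹ (rc (per e)) b z<s (trans e+2≡P (sym length-rc-per))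
               (subst (u <_) (cong (b *_) (sym length-rc-per)) u<) (subst (_∣ u + 2) (sym length-rc-per) P∣))
             at-rc-per-e)

  module Windows (e≥3 : 3 ≤ e) {q : Word} (mk : Markers q) (a b : ℕ) where
    open Markers mk
    open Flanked q a b

    <5⇒<P : ∀ {d} → d < 5 → d < P
    <5⇒<P d<5 = <-≤-trans d<5 (s≤s (s≤s e≥3))

    3<Q : 3 < Q
    3<Q = subst (3 <_) (sym length≡) (≤-trans (s≤s (s≤s (s≤s (s≤s z≤n)))) (m≤n+m 5 n₀))

    1<Q : 1 < Q
    1<Q = <-trans (s<s z<s) 3<Q

    n₀<Q : n₀ < Q
    n₀<Q = subst (n₀ <_) (sym length≡) (m<m+n n₀ z<s)

    n₀+3<Q : n₀ + 3 < Q
    n₀+3<Q = subst (n₀ + 3 <_) (sym length≡) (+-monoʳ-< n₀ (s<s (s<s (s<s z<s))))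

    ones-apart : ∀ {p d} → p + d < A → at F p ≡ true → at F (p + d) ≡ true → 0 < d → d < 5 → ⊥
    ones-apart {p} {d} p+d< h h′ 0<d d<5 =
      ∣-apart (at-F-one (≤-<-trans (m≤m+n p d) p+d<) h) (subst (P ∣_) shift (at-F-one p+d< h′)) 0<d (<5⇒<P d<5)
      where
      shift : p + d + suc e ≡ p + suc e + d
      shift = solve (p ∷ d ∷ e ∷ [])

    zeros-apart : ∀ {u d} → B + (u + d) < length F → at F (B + u) ≡ false → at F (B + (u + d)) ≡ false → 0 < d → d < 5 → ⊥
    zeros-apart {u} {d} u+d< h h′ 0<d d<5 =
      ∣-apart (at-F-zero (≤-<-trans (+-monoʳ-≤ B (m≤m+n u d)) u+d<) h) (subst (P ∣_) shift (at-F-zero u+d< h′)) 0<d (<5⇒<P d<5)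
      where
      shift : u + d + 2 ≡ u + 2 + d
      shift = solve (u ∷ d ∷ [])

    -- The window [s, s + L) of F covers q, the last x letters of per^a and the first y letters of rc(per)^b.
    record Window (s L X Y : ℕ) : Set where
      field
        x y       : ℕ
        left-end  : s + x ≡ A
        right-end : s + L ≡ B + y
        P≤x       : P ≤ x
        P≤y       : P ≤ y
        x≤        : x ≤ X * P
        y≤        : y ≤ Y * P

    -- A right completion of length ℓ = x + j reaching j ≥ 4 letters into q would turn the letters 1 at
    -- positions 1 and 3 of q into two letters 0 of rc(per)^b at distance 2. For j < P it pairs the
    -- last 1 of per^a with a 0 of rc(per)^b, which forces P ∣ y + j.
    module RightGrowth {s L X Y ℓ} (w : Window s L X Y) (fits : s + L + ℓ ≤ length F)
                       (pairs : RcFactors F ℓ s (s + L)) where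
      open Window w

      pairsʳ : ∀ {i r} → i + suc r ≡ ℓ → at F (B + (y + i)) ≡ not (at F (s + r))
      pairsʳ {i} i+1+r = trans (cong (at F) (trans (sym (+-assoc B y i)) (cong (_+ i) (sym right-end)))) (pairs i+1+r)

      inRange : ∀ {u} → u < y + ℓ → B + u < length F
      inRange {u} u< = <-≤-trans (+-monoʳ-< B u<) (subst (_≤ length F) (trans (cong (_+ ℓ) right-end) (+-assoc B y ℓ)) fits)

      at-q : ∀ {t} → t < Q → at F (s + (x + t)) ≡ at q t
      at-q {t} t< = trans (cong (at F) (trans (sym (+-assoc s x t)) (cong (_+ t) left-end))) (at-F-middle t<)

      far : ∀ j → ℓ ≡ x + (4 + j) → ⊥
      far j ℓ≡ = zeros-apart (inRange y+j+2<) zero₀′ zero₂′ z<s (s<s (s<s z<s))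
        where
        y+j+2< : y + j + 2 < y + ℓ
        y+j+2< = subst₂ _<_ (sym (+-assoc y j 2)) (cong (y +_) (sym ℓ≡))
                   (+-monoʳ-< y (subst (suc (j + 2) ≤_) (room x j) (m≤n+m (suc (j + 2)) (suc x))))
          where
          room : ∀ x j → suc x + suc (j + 2) ≡ x + (4 + j)
          room = solve-∀
        zero₀′ : at F (B + (y + j)) ≡ false
        zero₀′ = trans (pairsʳ (trans (pair x j) (sym ℓ≡))) (cong not (trans (at-q 3<Q) one₃))
          where
          pair : ∀ x j → j + suc (x + 3) ≡ x + (4 + j)
          pair = solve-∀
        zero₂′ : at F (B + (y + j + 2)) ≡ false
        zero₂′ = trans (cong (λ t → at F (B + t)) (+-assoc y j 2))
                   (trans (pairsʳ (trans (pair x j) (sym ℓ≡))) (cong not (trans (at-q 1<Q) one₁)))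
          where
          pair : ∀ x j → j + 2 + suc (x + 1) ≡ x + (4 + j)
          pair = solve-∀

      near : ∀ j → j < P → ℓ ≡ x + j → y + ℓ ≤ (X + Y) * P
      near j j<P ℓ≡ = subst (_≤ (X + Y) * P) (trans (swap x y j) (cong (y +_) (sym ℓ≡)))
                        (+-≤-*ʳ X Y P x≤ (∣⇒≤-rounded {W = Y} P∣y+j y≤ j<P))
        where
        swap : ∀ x y j → x + (y + j) ≡ y + (x + j)
        swap = solve-∀
        x₂ : ℕ
        x₂ = x ∸ P
        x≡ : P + x₂ ≡ x
        x≡ = m+[n∸m]≡n P≤x
        pos≡ : s + (x₂ + 1) + suc e ≡ A
        pos≡ = trans (shift s x₂ e) (trans (cong (s +_) x≡) left-end)
          where
          shift : ∀ s x₂ e → s + (x₂ + 1) + suc e ≡ s + (suc (suc e) + x₂)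
          shift = solve-∀
        one′ : at F (s + (x₂ + 1)) ≡ true
        one′ = at-F-one⁻¹ (subst (s + (x₂ + 1) <_) pos≡ (m<m+n _ z<s)) (subst (P ∣_) (sym pos≡) (n∣m*n a))
        zero′ : at F (B + (y + (j + e))) ≡ false
        zero′ = trans (pairsʳ (trans (pair j e x₂) (trans (cong (_+ j) x≡) (sym ℓ≡)))) (cong not one′)
          where
          pair : ∀ j e x₂ → j + e + suc (x₂ + 1) ≡ suc (suc e) + x₂ + j
          pair = solve-∀
        j+e<ℓ : j + e < ℓ
        j+e<ℓ = subst (j + e <_) (trans (+-comm j x) (sym ℓ≡)) (+-monoʳ-< j (<-≤-trans (m<n+m e {2} z<s) P≤x))
        P∣y+j : P ∣ y + j
        P∣y+j = ∣m+n∣m⇒∣n (subst (P ∣_) (shift y j e) (at-F-zero (inRange (+-monoʳ-< y j+e<ℓ)) zero′)) (n∣n {P})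
          where
          shift : ∀ y j e → y + (j + e) + 2 ≡ suc (suc e) + (y + j)
          shift = solve-∀

      bound : y + ℓ ≤ (X + Y) * P
      bound with ℓ ≤? x
      ... | yes ℓ≤x = subst (_≤ (X + Y) * P) (+-comm ℓ y) (+-≤-*ʳ X Y P (≤-trans ℓ≤x x≤) y≤)
      ... | no ℓ≰x = split (ℓ ∸ x) (sym (m+[n∸m]≡n (<⇒≤ (≰⇒> ℓ≰x))))
        where
        split : ∀ j → ℓ ≡ x + j → y + ℓ ≤ (X + Y) * P
        split j ℓ≡ with j <? 4
        ... | yes j<4 = near j (<5⇒<P (m<n⇒m<1+n j<4)) ℓ≡
        ... | no  j≮4 = ⊥-elim (far (j ∸ 4) (trans ℓ≡ (cong (x +_) (sym (m+[n∸m]≡n (≮⇒≥ j≮4))))))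

    -- Symmetrically, a left completion of length ℓ = y + j with j ≥ 5 would turn the letters 0 at
    -- positions |q| - 5 and |q| - 2 of q into two letters 1 of per^a at distance 3; for j < P it pairs
    -- the first 0 of rc(per)^b with a 1 of per^a, which forces P ∣ x + j.
    module LeftGrowth {t L X Y ℓ} (w : Window (t + ℓ) L X Y) (0<b : 0 < b)
                      (pairs : RcFactors F ℓ t (t + L)) where
      open Window w

      pairsˡ : ∀ {i r} → i + suc r ≡ ℓ → at F (t + i) ≡ not (at F (t + L + r))
      pairsˡ = rcFactors-sym {W = F} {p = t} {q = t + L} pairs

      end≡ : ∀ j → ℓ ≡ y + j → t + L + j ≡ B
      end≡ j ℓ≡ = +-cancelʳ-≡ y (t + L + j) B (trans (shift t L j y) (trans (cong (λ z → t + z + L) (sym ℓ≡)) right-end))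
        where
        shift : ∀ t L j y → t + L + j + y ≡ t + (y + j) + L
        shift = solve-∀

      below-A : ∀ {i} → i < ℓ → t + i < A
      below-A {i} i< = <-≤-trans (+-monoʳ-< t i<) (subst (t + ℓ ≤_) left-end (m≤m+n (t + ℓ) x))

      far : ∀ j → ℓ ≡ y + (5 + j) → ⊥
      far j ℓ≡ = ones-apart (subst (_< A) (sym (shift₁ t y)) (below-A y+4<ℓ)) one₁′
                   (subst (λ p → at F p ≡ true) (sym (shift₁ t y)) one₄′) z<s (s<s (s<s (s<s z<s)))
        where
        shift₁ : ∀ t y → t + (y + 1) + 3 ≡ t + (y + 4)
        shift₁ = solve-∀
        y+4<ℓ : y + 4 < ℓ
        y+4<ℓ = subst (y + 4 <_) (sym ℓ≡) (+-monoʳ-< y (s<s (s<s (s<s (s<s z<s)))))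
        base : t + L + j ≡ A + n₀
        base = +-cancelʳ-≡ 5 (t + L + j) (A + n₀)
                 (trans (shift₂ t L j) (trans (end≡ (5 + j) ℓ≡) (trans (cong (A +_) length≡) (sym (+-assoc A n₀ 5)))))
          where
          shift₂ : ∀ t L j → t + L + j + 5 ≡ t + L + (5 + j)
          shift₂ = solve-∀
        zero-n₀ : at F (t + L + j) ≡ false
        zero-n₀ = trans (cong (at F) base) (trans (at-F-middle n₀<Q) zero₀)
        zero-n₀+3 : at F (t + L + (j + 3)) ≡ false
        zero-n₀+3 = trans (cong (at F) (trans (sym (+-assoc (t + L) j 3)) (trans (cong (_+ 3) base) (+-assoc A n₀ 3))))
                      (trans (at-F-middle n₀+3<Q) zero₃)
        one₄′ : at F (t + (y + 4)) ≡ true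
        one₄′ = trans (pairsˡ (trans (pair y j) (sym ℓ≡))) (cong not zero-n₀)
          where
          pair : ∀ y j → y + 4 + suc j ≡ y + (5 + j)
          pair = solve-∀
        one₁′ : at F (t + (y + 1)) ≡ true
        one₁′ = trans (pairsˡ (trans (pair y j) (sym ℓ≡))) (cong not zero-n₀+3)
          where
          pair : ∀ y j → y + 1 + suc (j + 3) ≡ y + (5 + j)
          pair = solve-∀

      near : ∀ j → j < P → ℓ ≡ y + j → x + ℓ ≤ (X + Y) * P
      near j j<P ℓ≡ = subst (_≤ (X + Y) * P) (trans (+-assoc x j y) (cong (x +_) (trans (+-comm j y) (sym ℓ≡))))
                        (+-≤-*ʳ X Y P (∣⇒≤-rounded {W = X} P∣x+j x≤ j<P) y≤)
        where
        y₂ : ℕ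
        y₂ = y ∸ P
        y≡ : P + y₂ ≡ y
        y≡ = m+[n∸m]≡n P≤y
        zero′ : at F (t + L + (j + e)) ≡ false
        zero′ = trans (cong (at F) (trans (sym (+-assoc (t + L) j e)) (cong (_+ e) (end≡ j ℓ≡))))
                  (at-F-zero⁻¹ (e<n*P 0<b) (subst (P ∣_) (sym e+2≡P) (n∣n {P})))
        y₂+1<ℓ : y₂ + 1 < ℓ
        y₂+1<ℓ = subst (y₂ + 1 <_) (sym ℓ≡)
                   (<-≤-trans (subst (y₂ + 1 <_) (trans (+-comm y₂ P) y≡) (+-monoʳ-< y₂ (s<s z<s))) (m≤m+n y j))
        one′ : at F (t + (y₂ + 1)) ≡ true
        one′ = trans (pairsˡ (trans (pair y₂ j e) (trans (cong (_+ j) y≡) (sym ℓ≡)))) (cong not zero′)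
          where
          pair : ∀ y₂ j e → y₂ + 1 + suc (j + e) ≡ suc (suc e) + y₂ + j
          pair = solve-∀
        P∣t+y : P ∣ t + y
        P∣t+y = subst (P ∣_) (trans (shift t y₂ e) (cong (t +_) y≡)) (at-F-one (below-A y₂+1<ℓ) one′)
          where
          shift : ∀ t y₂ e → t + (y₂ + 1) + suc e ≡ t + (suc (suc e) + y₂)
          shift = solve-∀
        P∣x+j : P ∣ x + j
        P∣x+j = ∣m+n∣m⇒∣n
                  (subst (P ∣_) (trans (sym left-end) (trans (cong (λ z → t + z + x) ℓ≡) (shift t y j x))) (n∣m*n a)) P∣t+y
          where
          shift : ∀ t y j x → t + (y + j) + x ≡ t + y + (x + j)
          shift = solve-∀

      bound : x + ℓ ≤ (X + Y) * P
      bound with ℓ ≤? y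
      ... | yes ℓ≤y = +-≤-*ʳ X Y P x≤ (≤-trans ℓ≤y y≤)
      ... | no ℓ≰y = split (ℓ ∸ y) (sym (m+[n∸m]≡n (<⇒≤ (≰⇒> ℓ≰y))))
        where
        split : ∀ j → ℓ ≡ y + j → x + ℓ ≤ (X + Y) * P
        split j ℓ≡ with j <? 5
        ... | yes j<5 = near j (<5⇒<P j<5) ℓ≡
        ... | no  j≮5 = ⊥-elim (far (j ∸ 5) (trans ℓ≡ (cong (y +_) (sym (m+[n∸m]≡n (≮⇒≥ j≮5))))))

    window-rightCompletion : ∀ {s U X Y ℓ} → ℓ ≤ length U → Window s (length U) X Y →
      OccursAt (U ++ rc (take ℓ U)) F s → Window s (length (U ++ rc (take ℓ U))) X (X + Y)
    window-rightCompletion {s} {U} {X} {Y} {ℓ} ℓ≤ w V⊑F = subst (λ L → Window s L X (X + Y)) (sym |V|≡) (record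
      { x = x ; y = y + ℓ ; left-end = left-end
      ; right-end = trans (sym (+-assoc s (length U) ℓ)) (trans (cong (_+ ℓ) right-end) (+-assoc B y ℓ))
      ; P≤x = P≤x ; P≤y = ≤-trans P≤y (m≤m+n y ℓ)
      ; x≤ = x≤ ; y≤ = RightGrowth.bound w fits′ pairs })
      where
      open Window w
      |V|≡ : length (U ++ rc (take ℓ U)) ≡ length U + ℓ
      |V|≡ = length-rightCompletion U ℓ≤
      fits′ : s + length U + ℓ ≤ length F
      fits′ = subst (_≤ length F) (trans (cong (s +_) |V|≡) (sym (+-assoc s (length U) ℓ))) (fits V⊑F)
      pairs : RcFactors F ℓ s (s + length U)
      pairs = occursAt-rcFactors V⊑F (rightCompletion-rcFactors U ℓ≤) (≤-reflexive (sym |V|≡))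

    window-leftCompletion : ∀ {t U X Y ℓ} → 0 < b → ℓ ≤ length U → Window (t + ℓ) (length U) X Y →
      OccursAt (rc (drop (length U ∸ ℓ) U) ++ U) F t → Window t (length (rc (drop (length U ∸ ℓ) U) ++ U)) (X + Y) Y
    window-leftCompletion {t} {U} {X} {Y} {ℓ} 0<b ℓ≤ w V⊑F = subst (λ L → Window t L (X + Y) Y) (sym |V|≡) (record
      { x = x + ℓ ; y = y
      ; left-end = trans (cong (t +_) (+-comm x ℓ)) (trans (sym (+-assoc t ℓ x)) left-end)
      ; right-end = trans (cong (t +_) (+-comm (length U) ℓ)) (trans (sym (+-assoc t ℓ (length U))) right-end)
      ; P≤x = ≤-trans P≤x (m≤m+n x ℓ) ; P≤y = P≤y
      ; x≤ = LeftGrowth.bound w 0<b pairs ; y≤ = y≤ })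
      where
      open Window w
      |V|≡ : length (rc (drop (length U ∸ ℓ) U) ++ U) ≡ length U + ℓ
      |V|≡ = length-leftCompletion U ℓ≤
      pairs : RcFactors F ℓ t (t + length U)
      pairs = occursAt-rcFactors V⊑F (leftCompletion-rcFactors U ℓ≤) (≤-reflexive (sym |V|≡))

    window-final : ∀ {X Y} → Window 0 (length F) X Y → a ≤ X × b ≤ Y
    window-final {X} {Y} w =
      *-cancelʳ-≤ a X P (subst (_≤ X * P) left-end x≤) ,
      *-cancelʳ-≤ b Y P (subst (_≤ Y * P) (+-cancelˡ-≡ B y (b * P) (trans (sym right-end) length-F)) y≤)
      where open Window w

    window-fib : ∀ {n U k i X Y} (sq : HairpinSeq n U F) → 0 < b → Window (offset sq) (length U) X Y →
      FibBounded k i X Y → FibBounded k (n + i) a b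
    window-fib done _ w fb = let a≤X , b≤Y = window-final w in fibBounded-mono a≤X b≤Y fb
    window-fib {suc n} {k = k} {i} (step (right ℓ _ ℓ≤) sq) 0<b w fb =
      subst (λ m → FibBounded k m a b) (+-suc n i)
        (window-fib sq 0<b (window-rightCompletion ℓ≤ w (offset-occursAt sq)) (fibBounded-right fb))
    window-fib {suc n} {k = k} {i} (step (left ℓ _ ℓ≤) sq) 0<b w fb =
      subst (λ m → FibBounded k m a b) (+-suc n i)
        (window-fib sq 0<b (window-leftCompletion 0<b ℓ≤ w (offset-occursAt sq)) (fibBounded-left fb))

    -- The start word sits in F exactly at the canonical place: if its copy of q started at g ≠ A, the
    -- same spacing argument applied to the markers of q, or to the period of per^k or rc(per)^k next
    -- to it, would produce two letters 1 (or two letters 0) closer than P.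
    module Alignment {k s} (0<k : 0 < k) (I⊑F : OccursAt (Flanked.F q k k) F s) where
      module I = Flanked q k k

      g : ℕ
      g = s + k * P

      IB≤ : I.B ≤ length I.F
      IB≤ = subst (I.B ≤_) (sym I.length-F) (m≤m+n I.B (k * P))

      g+Q≤ : g + Q ≤ length F
      g+Q≤ = ≤-trans (≤-reflexive (+-assoc s (k * P) Q)) (≤-trans (+-monoʳ-≤ s IB≤) (fits I⊑F))

      at-g : ∀ {r} → r < Q → at F (g + r) ≡ at q r
      at-g {r} r< = trans (cong (at F) (+-assoc s (k * P) r))
        (trans (agrees I⊑F (<-≤-trans (+-monoʳ-< (k * P) r<) IB≤)) (I.at-F-middle r<))

      low : g < A → ⊥
      low g<A with g + 3 <? A
      ... | yes g+3<A = ones-apart (subst (_< A) (sym (+-assoc g 1 2)) g+3<A) (trans (at-g 1<Q) one₁)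
                          (trans (cong (at F) (+-assoc g 1 2)) (trans (at-g 3<Q) one₃)) z<s (s<s (s<s z<s))
      ... | no g+3≮A = ∣-apart P∣g (subst (P ∣_) (sym g+d≡A) (n∣m*n a)) (m<n⇒0<n∸m g<A) (<5⇒<P (s≤s (m≤n⇒m≤1+n d≤3)))
        where
        d : ℕ
        d = A ∸ g
        g+d≡A : g + d ≡ A
        g+d≡A = m+[n∸m]≡n (<⇒≤ g<A)
        d≤3 : d ≤ 3
        d≤3 = +-cancelˡ-≤ g d 3 (subst (_≤ g + 3) (sym g+d≡A) (≮⇒≥ g+3≮A))
        k₁ : ℕ
        k₁ = k ∸ 1
        k*P≡ : P + k₁ * P ≡ k * P
        k*P≡ = cong (_* P) (m+[n∸m]≡n 0<k)
        p : ℕ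
        p = k₁ * P + 1
        p+e+1≡ : p + suc e ≡ k * P
        p+e+1≡ = trans (shift k₁ e) k*P≡
          where
          shift : ∀ k₁ e → k₁ * suc (suc e) + 1 + suc e ≡ suc (suc e) + k₁ * suc (suc e)
          shift = solve-∀
        p<k*P : p < k * P
        p<k*P = subst (p <_) p+e+1≡ (m<m+n p z<s)
        one-in-I : at F (s + p) ≡ true
        one-in-I = trans (agrees I⊑F (<-≤-trans p<k*P (≤-trans (m≤m+n (k * P) Q) IB≤)))
                         (I.at-F-one⁻¹ p<k*P (subst (P ∣_) (sym p+e+1≡) (n∣m*n k)))
        P∣g : P ∣ g
        P∣g = subst (P ∣_) (trans (+-assoc s p (suc e)) (cong (s +_) p+e+1≡))
                (at-F-one (<-trans (+-monoʳ-< s p<k*P) g<A) one-in-I)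

      high : A < g → ⊥
      high A<g = split (h <? 5)
        where
        h : ℕ
        h = g ∸ A
        A+h≡g : A + h ≡ g
        A+h≡g = m+[n∸m]≡n (<⇒≤ A<g)
        position : s + (I.B + e) ≡ B + (h + e)
        position = trans (shift₁ s (k * P) Q e) (trans (cong (λ z → z + Q + e) (sym A+h≡g)) (shift₂ A h Q e))
          where
          shift₁ : ∀ s u Q e → s + (u + Q + e) ≡ s + u + Q + e
          shift₁ = solve-∀
          shift₂ : ∀ A h Q e → A + h + Q + e ≡ A + Q + (h + e)
          shift₂ = solve-∀
        IB+e< : I.B + e < length I.F
        IB+e< = subst (I.B + e <_) (sym I.length-F) (+-monoʳ-< I.B (e<n*P 0<k))
        zero-in-I : at F (B + (h + e)) ≡ false
        zero-in-I = trans (cong (at F) (sym position))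
                      (trans (agrees I⊑F IB+e<) (I.at-F-zero⁻¹ (e<n*P 0<k) (subst (P ∣_) (sym e+2≡P) (n∣n {P}))))
        P∣h : P ∣ h
        P∣h = ∣m+n∣m⇒∣n (subst (P ∣_) (shift h e) (at-F-zero range zero-in-I)) (n∣n {P})
          where
          range : B + (h + e) < length F
          range = subst (_< length F) position (<-≤-trans (+-monoʳ-< s IB+e<) (fits I⊑F))
          shift : ∀ h e → h + e + 2 ≡ suc (suc e) + h
          shift = solve-∀
        split : Dec (h < 5) → ⊥
        split (yes h<5) = ∣-apart (P ∣0) P∣h (m<n⇒0<n∸m A<g) (<5⇒<P h<5)
        split (no  h≮5) = zeros-apart (subst (_< length F) pos₃ (<-≤-trans (+-monoʳ-< g n₀+3<Q) g+Q≤))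
                          (trans (cong (at F) (sym pos₀)) (trans (at-g n₀<Q) zero₀))
                          (trans (cong (at F) (sym pos₃)) (trans (at-g n₀+3<Q) zero₃)) z<s (s<s (s<s (s<s z<s)))
          where
          h′ : ℕ
          h′ = h ∸ 5
          pos₀ : g + n₀ ≡ B + h′
          pos₀ = begin
            g + n₀              ≡⟨ cong (_+ n₀) A+h≡g ⟨
            A + h + n₀          ≡⟨ cong (λ z → A + z + n₀) (m+[n∸m]≡n (≮⇒≥ h≮5)) ⟨
            A + (5 + h′) + n₀   ≡⟨ shift A h′ n₀ ⟩
            A + (n₀ + 5) + h′   ≡⟨ cong (λ z → A + z + h′) length≡ ⟨
            B + h′              ∎
            where
            shift : ∀ A h′ n₀ → A + (5 + h′) + n₀ ≡ A + (n₀ + 5) + h′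
            shift = solve-∀
          pos₃ : g + (n₀ + 3) ≡ B + (h′ + 3)
          pos₃ = trans (sym (+-assoc g n₀ 3)) (trans (cong (_+ 3) pos₀) (+-assoc B h′ 3))

      aligned : s + k * P ≡ A
      aligned with <-cmp g A
      ... | tri< g<A _ _ = ⊥-elim (low g<A)
      ... | tri≈ _ g≡A _ = g≡A
      ... | tri> _ _ A<g = ⊥-elim (high A<g)

    init-window : ∀ {k s} → 0 < k → OccursAt (Flanked.F q k k) F s → Window s (length (Flanked.F q k k)) k k
    init-window {k} {s} 0<k I⊑F = record
      { x = k * P ; y = k * P
      ; left-end = aligned
      ; right-end = trans (cong (s +_) I.length-F) (trans (shift s (k * P) Q) (cong (λ z → z + Q + k * P) aligned))
      ; P≤x = P≤k*P ; P≤y = P≤k*P ; x≤ = ≤-refl ; y≤ = ≤-refl }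
      where
      open Alignment 0<k I⊑F
      shift : ∀ s u Q → s + (u + Q + u) ≡ s + u + Q + u
      shift = solve-∀
      P≤k*P : P ≤ k * P
      P≤k*P = m≤n*m P k {{>-nonZero 0<k}}

lemma33 : (ext : ℕ) → 3 ≤ ext →
    (q : Word) →
    InPattern (false ∷ true ∷ false ∷ true ∷ []) (true ∷ true ∷ bar (true ∷ true ∷ [])) (bar (true ∷ false ∷ false ∷ true ∷ false ∷ [])) q →
    (k : ℕ) → 1 ≤ k → (a b : ℕ) → k ≤ a → k ≤ b → (m : ℕ) →
    HairpinSeq m (pow (per ext) k ++ q ++ pow (rc (per ext)) k) (pow (per ext) a ++ q ++ pow (rc (per ext)) b) →
    (a ⊓ b ≤ k * Fib m) × (a ⊔ b ≤ k * Fib (suc m))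
lemma33 ext ext≥3 q q∈pattern k 0<k a b _ k≤b m sq = FibBounded.min≤ bound , FibBounded.max≤ bound
  where
  open Period ext
  open Windows ext≥3 (inPattern⇒markers q∈pattern) a b
  bound : FibBounded k m a b
  bound = subst (λ i → FibBounded k i a b) (+-identityʳ m)
            (window-fib sq (≤-trans 0<k k≤b) (init-window 0<k (offset-occursAt sq)) (fibBounded-base k))
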